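{- Let $G$ be an edge-colored graph with colors $c_1,\dots,c_k$ such that for each $i=1,\dots,k$ the subgraph of edges of color $c_i$ contains a matching of size $2i$. Let $v$ be an arbitrary vertex of $G$. Then $G\setminus\{v\}$ has a rainbow matching of size $k$.
   Context: A matching is a set of pairwise vertex-disjoint edges. In an edge-colored graph, a rainbow matching is a matching in which no two edges have the same color. $G\setminus\{v\}$ denotes the graph obtained by deleting $v$ and its incident edges. -}

module Defs where

open import Data.Nat using (ℕ; suc; _*_)
open import Data.Fin using (Fin; toℕ)
open import Data.List using (List; length)
open import Data.List.Membership.Propositional using (_∈_)
open import Data.List.Relation.Unary.All using (All)
open import Data.List.Relation.Unary.AllPairs using (AllPairs)
open import Data.Product using (_×_; Σ)
open import Relation.Binary.PropositionalEquality using (_≡_; _≢_)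
open import Relation.Nullary using (¬_)

-- An edge on vertex set Fin n, coloured with one of k colours (Fin k).
-- Colour c_i (i = 1..k) of the paper is the element i-1 of Fin k.
record Edge (n k : ℕ) : Set where
  constructor edge
  field
    u   : Fin n
    v   : Fin n
    col : Fin k
open Edge public

SameEnds : ∀ {n k} → Edge n k → Edge n k → Set
SameEnds e f = (u e ≡ u f × v e ≡ v f) Data.Sum.⊎ (u e ≡ v f × v e ≡ u f)
  where import Data.Sum

Incident : ∀ {n k} → Fin n → Edge n k → Set
Incident x e = (x ≡ u e) Data.Sum.⊎ (x ≡ v e)
  where import Data.Sum

Disjoint : ∀ {n k} → Edge n k → Edge n k → Set
Disjoint e f = ¬ Incident (u e) f × ¬ Incident (v e) f

-- A finite simple edge-coloured graph on vertex set Fin n: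
-- a list of edges, no loops, no two edges on the same pair of vertices
-- (each edge carries exactly one colour).
record ColGraph (n k : ℕ) : Set where
  field
    edges   : List (Edge n k)
    noLoops : All (λ e → u e ≢ v e) edges
    simple  : AllPairs (λ e f → ¬ SameEnds e f) edges
open ColGraph public

IsMatching : ∀ {n k} → ColGraph n k → List (Edge n k) → Set
IsMatching G M = All (_∈ edges G) M × AllPairs Disjoint M

HasColourMatching : ∀ {n k} → ColGraph n k → Fin k → ℕ → Set
HasColourMatching G c m =
  Σ (List _) λ M → IsMatching G M × All (λ e → col e ≡ c) M × length M ≡ m

-- M is a rainbow matching of G ∖ {x}: a matching of G avoiding x,
-- with pairwise distinct colours.
IsRainbowMatchingAvoiding : ∀ {n k} → ColGraph n k → Fin n → List (Edge n k) → Set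
IsRainbowMatchingAvoiding G x M =
  IsMatching G M × All (λ e → ¬ Incident x e) M
  × AllPairs (λ e f → col e ≢ col f) M

-- Greedy construction: take one edge of each colour, in the order c₁, …, c_k.
-- Before choosing colour c_{j+1} the current rainbow matching has j edges, so
-- together with v it blocks 2j+1 vertices. The colour-(j+1) matching has
-- 2(j+1) = 2j+2 pairwise disjoint edges, and a blocked vertex lies on at most
-- one of them, so one of its edges misses every blocked vertex and can be added.
module Submission where

open import Defs
open import Data.Nat using (ℕ; zero; suc; _+_; _*_; _<_; _≤_)
open import Data.Nat.Properties
  using (*-suc; n<1+n; m<n⇒m<1+n; <⇒≤; <-irrefl; ≤-pred; ≤-refl; ≤-reflexive; module ≤-Reasoning)
open import Data.Fin using (Fin; toℕ; fromℕ<)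
open import Data.Fin.Properties using (_≟_; toℕ-fromℕ<)
open import Data.List using (List; []; _∷_; length)
open import Data.List.Properties using (length-removeAt′)
open import Data.List.Membership.Propositional using (_∈_)
open import Data.List.Relation.Unary.Any as Any using (here; there; any?; _─_; index)
open import Data.List.Relation.Unary.Any.Properties using (lookup-result)
open import Data.List.Relation.Unary.All as All using (All; []; _∷_)
open import Data.List.Relation.Unary.All.Properties using (¬Any⇒All¬; ─⁻)
open import Data.List.Relation.Unary.AllPairs using (AllPairs; []; _∷_)
open import Data.Product using (Σ; _×_; _,_)
open import Data.Sum using (inj₁; inj₂)
open import Relation.Nullary using (¬_; Dec; yes; no)
open import Relation.Nullary.Decidable using (_⊎-dec_)
open import Relation.Binary.PropositionalEquality using (_≡_; _≢_; refl; sym; trans; cong; subst)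

module _ {n k : ℕ} where

  incident? : (y : Fin n) (e : Edge n k) → Dec (Incident y e)
  incident? y e = (y ≟ u e) ⊎-dec (y ≟ v e)

  disjoint-sym : {e f : Edge n k} → Disjoint e f → Disjoint f e
  disjoint-sym (ue∉f , ve∉f) =
    (λ { (inj₁ eq) → ue∉f (inj₁ (sym eq)) ; (inj₂ eq) → ve∉f (inj₁ (sym eq)) }) ,
    (λ { (inj₁ eq) → ue∉f (inj₂ (sym eq)) ; (inj₂ eq) → ve∉f (inj₂ (sym eq)) })

  incident⇒¬incident-disjoint : {y : Fin n} {e f : Edge n k} →
    Incident y e → Disjoint e f → ¬ Incident y f
  incident⇒¬incident-disjoint (inj₁ refl) (ue∉f , _) = ue∉f
  incident⇒¬incident-disjoint (inj₂ refl) (_ , ve∉f) = ve∉f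

  Avoids : List (Fin n) → Edge n k → Set
  Avoids B e = All (λ y → ¬ Incident y e) B

  -- Pigeonhole: each vertex of B meets at most one edge of the disjoint family N.
  avoiding-edge : (N : List (Edge n k)) → AllPairs Disjoint N →
    (B : List (Fin n)) → length B < length N → Σ (Edge n k) λ e → e ∈ N × Avoids B e
  avoiding-edge (e ∷ N) (e#N ∷ N-disjoint) B |B|<|e∷N| with any? (λ y → incident? y e) B
  ... | no B∌e = e , here refl , ¬Any⇒All¬ B B∌e
  ... | yes b∼e with avoiding-edge N N-disjoint (B ─ b∼e) |B─b|<|N|
    where
    |B─b|<|N| : length (B ─ b∼e) < length N
    |B─b|<|N| = ≤-pred (subst (_< suc (length N)) (length-removeAt′ B (index b∼e)) |B|<|e∷N|)
  ... | f , f∈N , f-avoids = f , there f∈N , ─⁻ b∼e b∉f f-avoids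
    where
    b∉f : ¬ Incident (Any.lookup b∼e) f
    b∉f = incident⇒¬incident-disjoint {e = e} {f} (lookup-result b∼e) (All.lookup e#N f∈N)

  endpoints : List (Edge n k) → List (Fin n)
  endpoints []      = []
  endpoints (f ∷ M) = u f ∷ v f ∷ endpoints M

  length-endpoints : (M : List (Edge n k)) → length (endpoints M) ≡ 2 * length M
  length-endpoints []      = refl
  length-endpoints (f ∷ M) =
    trans (cong (λ l → suc (suc l)) (length-endpoints M)) (sym (*-suc 2 (length M)))

  avoids-endpoints⇒disjoint : (M : List (Edge n k)) (e : Edge n k) →
    Avoids (endpoints M) e → All (Disjoint e) M
  avoids-endpoints⇒disjoint []      e []                     = []
  avoids-endpoints⇒disjoint (f ∷ M) e (uf∉e ∷ vf∉e ∷ M-avoids) =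
    disjoint-sym {f} {e} (uf∉e , vf∉e) ∷ avoids-endpoints⇒disjoint M e M-avoids

  rainbow-∷ : {G : ColGraph n k} {x : Fin n} {e : Edge n k} {M : List (Edge n k)} →
    e ∈ edges G → ¬ Incident x e → All (Disjoint e) M → All (λ f → col e ≢ col f) M →
    IsRainbowMatchingAvoiding G x M → IsRainbowMatchingAvoiding G x (e ∷ M)
  rainbow-∷ e∈G x∉e e#M e≢M ((M⊆G , M-disjoint) , x∉M , M-rainbow) =
    (e∈G ∷ M⊆G , e#M ∷ M-disjoint) , x∉e ∷ x∉M , e≢M ∷ M-rainbow

  colour-fresh : {j : ℕ} {c : Fin k} {M : List (Edge n k)} → toℕ c ≡ j →
    All (λ f → toℕ (col f) < j) M → All (λ f → c ≢ col f) M
  colour-fresh refl = All.map λ { c<c refl → <-irrefl refl c<c }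

  RainbowBelow : ColGraph n k → Fin n → ℕ → List (Edge n k) → Set
  RainbowBelow G x j M =
    IsRainbowMatchingAvoiding G x M × length M ≡ j × All (λ f → toℕ (col f) < j) M

  module _ (G : ColGraph n k) (x : Fin n) where

    extend-rainbow : {j : ℕ} (j<k : j < k) →
      HasColourMatching G (fromℕ< j<k) (2 * suc j) →
      {M : List (Edge n k)} → RainbowBelow G x j M →
      Σ (List (Edge n k)) (RainbowBelow G x (suc j))
    extend-rainbow j<k (N , (N⊆G , N-disjoint) , N-col , |N|) {M} (M-rainbow , refl , M-below)
      with avoiding-edge N N-disjoint (x ∷ endpoints M) blocked<|N|
      where
      open ≤-Reasoning
      blocked<|N| : length (x ∷ endpoints M) < length N
      blocked<|N| = begin-strict
        suc (length (endpoints M))  ≡⟨ cong suc (length-endpoints M) ⟩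
        suc (2 * length M)          <⟨ n<1+n _ ⟩
        2 + 2 * length M            ≡⟨ sym (*-suc 2 (length M)) ⟩
        2 * suc (length M)          ≡⟨ sym |N| ⟩
        length N                    ∎
    ... | e , e∈N , x∉e ∷ e-avoids =
      e ∷ M ,
      rainbow-∷ {G} {x} (All.lookup N⊆G e∈N) x∉e (avoids-endpoints⇒disjoint M e e-avoids)
                (colour-fresh colour-e M-below) M-rainbow ,
      refl ,
      ≤-reflexive (cong suc colour-e) ∷ All.map m<n⇒m<1+n M-below
      where
      colour-e : toℕ (col e) ≡ length M
      colour-e = trans (cong toℕ (All.lookup N-col e∈N)) (toℕ-fromℕ< j<k)

    greedy-rainbow : ((i : Fin k) → HasColourMatching G i (2 * suc (toℕ i))) →
      (j : ℕ) → j ≤ k → Σ (List (Edge n k)) (RainbowBelow G x j)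
    greedy-rainbow H zero    _   = [] , (([] , []) , [] , []) , refl , []
    greedy-rainbow H (suc j) j<k with greedy-rainbow H j (<⇒≤ j<k)
    ... | M , M-below =
      extend-rainbow j<k (subst (HasColourMatching G (fromℕ< j<k))
                                (cong (λ i → 2 * suc i) (toℕ-fromℕ< j<k))
                                (H (fromℕ< j<k)))
                     M-below

lemma6 : (n k : ℕ) (G : ColGraph n k) →
    ((i : Fin k) → HasColourMatching G i (2 * suc (toℕ i))) →
    (x : Fin n) →
    Σ (List (Edge n k)) λ M → IsRainbowMatchingAvoiding G x M × length M ≡ k
lemma6 n k G H x with greedy-rainbow G x H k ≤-refl
... | M , M-rainbow , |M| , _ = M , M-rainbow , |M|
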